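{- Let $\mathbb{K}=(G,M,I)$ be a finite formal context such that $\emptyset''\neq\emptyset$ (i.e. some object has all attributes of $M$), and let $\mathbb{K}_a=(G,M\cup\{a\},I\cup\{(g,a)\mid g\in a'\})$ be obtained by adding a new attribute $a\notin M$ with $a'=G\setminus\emptyset''$. Then $|\mathfrak{B}(\mathbb{K}_a)|=2\cdot|\mathfrak{B}(\mathbb{K})|$.
   Context: For a formal context $(G,M,I)$, $X'$ denotes the derivation of a set of objects (attributes shared by all of them) or of a set of attributes (objects having all of them); $\emptyset''=M'$ is the set of objects having every attribute in $M$. A formal concept is a pair $(A,B)$ with $A'=B$, $B'=A$, and $\mathfrak{B}(\mathbb{K})$ is the set of concepts. -}

module Defs where

open import Data.Nat using (ℕ; zero; suc; _*_)
open import Data.Bool using (Bool; true; false; not; _∧_; _∨_)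
open import Data.Fin using (Fin; zero; suc)
open import Data.Fin.Subset using (Subset; ⊥; Nonempty)
open import Data.Vec using (Vec; []; _∷_; tabulate; lookup)
open import Data.Vec.Properties using (≡-dec)
open import Data.List using (List; []; _∷_; map; _++_; length; filter; cartesianProduct)
open import Data.Product using (_×_; _,_)
open import Data.Product.Properties using () renaming (≡-dec to ×-≡-dec)
open import Relation.Binary.PropositionalEquality using (_≡_)
open import Relation.Nullary using (Dec)
open import Relation.Nullary.Decidable using (_×-dec_)
import Data.Bool.Properties as BP

-- A finite formal context with objects G = Fin n and attributes M = Fin m;
-- the incidence relation I is given by its (decidable) characteristic function.
Context : ℕ → ℕ → Set
Context n m = Fin n → Fin m → Bool

allᶠ : {k : ℕ} → (Fin k → Bool) → Bool
allᶠ {zero}  f = true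
allᶠ {suc k} f = f zero ∧ allᶠ (λ i → f (suc i))

_↑_ : {n m : ℕ} → Context n m → Subset n → Subset m
I ↑ A = tabulate λ j → allᶠ (λ g → not (lookup A g) ∨ I g j)

_↓_ : {n m : ℕ} → Context n m → Subset m → Subset n
I ↓ B = tabulate λ g → allᶠ (λ j → not (lookup B j) ∨ I g j)

-- ∅'' = M' : objects having every attribute (∅ ⊆ G, ∅' = M)
emptyDD : {n m : ℕ} → Context n m → Subset n
emptyDD I = I ↓ (I ↑ ⊥)

IsConcept : {n m : ℕ} → Context n m → Subset n × Subset m → Set
IsConcept I (A , B) = (I ↑ A ≡ B) × (I ↓ B ≡ A)

isConcept? : {n m : ℕ} (I : Context n m) (p : Subset n × Subset m) → Dec (IsConcept I p)
isConcept? I (A , B) = ≡-dec BP._≟_ (I ↑ A) B ×-dec ≡-dec BP._≟_ (I ↓ B) A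

allSubsets : (n : ℕ) → List (Subset n)
allSubsets zero    = [] ∷ []
allSubsets (suc n) = map (true ∷_) (allSubsets n) ++ map (false ∷_) (allSubsets n)

numConcepts : {n m : ℕ} → Context n m → ℕ
numConcepts {n} {m} I = length (filter (isConcept? I) (cartesianProduct (allSubsets n) (allSubsets m)))

-- K_a : add a new attribute a (index zero of Fin (suc m); old attributes
-- are embedded via suc) with a' = G ∖ ∅''
addAttr : {n m : ℕ} → Context n m → Context n (suc m)
addAttr I g zero    = not (lookup (emptyDD I) g)
addAttr I g (suc j) = I g j

module Submission where

-- A pair (A , B) is a concept iff B = A' and A'' = A, so |𝔅(K)| is the number
-- of closed object sets, the A ⊆ G with cl A = A where cl A = A''.  Put
-- E = ∅''.  Every object of E has every attribute, hence E ⊆ cl A for all A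
-- and (A ∪ E)' = A'.  In K_a the new attribute lies in A' exactly when
-- A ∩ E = ∅, so the closure of A in K_a is cl A if A meets E and cl A ∖ E
-- otherwise.  The closed sets of K_a are therefore the closed sets of K (they
-- contain the nonempty E) together with the sets A disjoint from E for which
-- A ∪ E is closed in K; since A ↦ A ∪ E maps the sets disjoint from E
-- bijectively onto the sets containing E, the latter are as many as the
-- closed sets of K.

open import Defs
open import Data.Nat using (ℕ; zero; suc; _+_; _*_)
open import Data.Nat.Properties using (+-identityʳ; *-zeroʳ; +-commutativeSemigroup)
open import Algebra.Properties.CommutativeSemigroup +-commutativeSemigroup using (interchange)
open import Data.Nat.ListAction using (sum)
open import Data.Nat.ListAction.Properties using (sum-++)
open import Data.Bool using (Bool; true; false; not; _∧_; _∨_)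
open import Data.Bool.Properties using (_≟_; ∧-comm; ∧-identityʳ; ∨-identityʳ; ∨-zeroʳ)
open import Data.Fin using (Fin; zero; suc)
open import Data.Fin.Subset using (Subset; Nonempty; ⊥; _∪_; _∩_; ∁)
open import Data.Vec using (Vec; []; _∷_; tabulate; lookup)
open import Data.Vec.Properties
  using (≡-dec; lookup∘tabulate; tabulate∘lookup; tabulate-cong; lookup-zipWith; lookup-map; lookup-replicate; []=⇒lookup)
open import Data.List using (List; []; _∷_; map; _++_; length; filter; cartesianProduct)
open import Data.List.Properties using (map-++; map-∘)
open import Data.Product using (_×_; _,_)
open import Function using (_∘_; _⇔_; mk⇔; Equivalence)
open import Relation.Binary.PropositionalEquality using (_≡_; refl; sym; trans; cong; cong₂; module ≡-Reasoning)
open import Relation.Nullary using (does; yes; no; contradiction)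
open import Relation.Nullary.Decidable using (dec-false; does-⇔)
open import Relation.Unary using (Pred; Decidable)

open ≡-Reasoning

𝟙 : Bool → ℕ
𝟙 true  = 1
𝟙 false = 0

length-filter≡count : ∀ {a p} {A : Set a} {P : Pred A p} (P? : Decidable P) (xs : List A) →
  length (filter P? xs) ≡ sum (map (λ x → 𝟙 (does (P? x))) xs)
length-filter≡count P? []       = refl
length-filter≡count P? (x ∷ xs) with does (P? x)
... | true  = cong suc (length-filter≡count P? xs)
... | false = length-filter≡count P? xs

sum-map-++ : ∀ {a} {A : Set a} (f : A → ℕ) (xs ys : List A) →
  sum (map f (xs ++ ys)) ≡ sum (map f xs) + sum (map f ys)
sum-map-++ f xs ys = trans (cong sum (map-++ f xs ys)) (sum-++ (map f xs) (map f ys))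

sum-cartesianProduct : ∀ {a b} {A : Set a} {B : Set b} (f : A × B → ℕ) (xs : List A) (ys : List B) →
  sum (map f (cartesianProduct xs ys)) ≡ sum (map (λ x → sum (map (λ y → f (x , y)) ys)) xs)
sum-cartesianProduct f []       ys = refl
sum-cartesianProduct f (x ∷ xs) ys = begin
  sum (map f (map (x ,_) ys ++ cartesianProduct xs ys))
    ≡⟨ sum-map-++ f (map (x ,_) ys) (cartesianProduct xs ys) ⟩
  sum (map f (map (x ,_) ys)) + sum (map f (cartesianProduct xs ys))
    ≡⟨ cong₂ _+_ (cong sum (sym (map-∘ ys))) (sum-cartesianProduct f xs ys) ⟩
  sum (map (λ y → f (x , y)) ys) + sum (map (λ x → sum (map (λ y → f (x , y)) ys)) xs) ∎

sumSubsets : (n : ℕ) → (Subset n → ℕ) → ℕ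
sumSubsets zero    f = f []
sumSubsets (suc n) f = sumSubsets n (f ∘ (true ∷_)) + sumSubsets n (f ∘ (false ∷_))

sum-allSubsets : ∀ n (f : Subset n → ℕ) → sum (map f (allSubsets n)) ≡ sumSubsets n f
sum-allSubsets zero    f = +-identityʳ (f [])
sum-allSubsets (suc n) f = begin
  sum (map f (map (true ∷_) 𝒫 ++ map (false ∷_) 𝒫))
    ≡⟨ sum-map-++ f (map (true ∷_) 𝒫) (map (false ∷_) 𝒫) ⟩
  sum (map f (map (true ∷_) 𝒫)) + sum (map f (map (false ∷_) 𝒫))
    ≡⟨ cong₂ _+_ (cong sum (sym (map-∘ 𝒫))) (cong sum (sym (map-∘ 𝒫))) ⟩
  sum (map (f ∘ (true ∷_)) 𝒫) + sum (map (f ∘ (false ∷_)) 𝒫)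
    ≡⟨ cong₂ _+_ (sum-allSubsets n (f ∘ (true ∷_))) (sum-allSubsets n (f ∘ (false ∷_))) ⟩
  sumSubsets (suc n) f ∎
  where 𝒫 = allSubsets n

sumSubsets-cong : ∀ n {f g : Subset n → ℕ} → (∀ A → f A ≡ g A) → sumSubsets n f ≡ sumSubsets n g
sumSubsets-cong zero    f≗g = f≗g []
sumSubsets-cong (suc n) f≗g =
  cong₂ _+_ (sumSubsets-cong n (f≗g ∘ (true ∷_))) (sumSubsets-cong n (f≗g ∘ (false ∷_)))

sumSubsets-zero : ∀ n → sumSubsets n (λ _ → 0) ≡ 0
sumSubsets-zero zero    = refl
sumSubsets-zero (suc n) = cong₂ _+_ (sumSubsets-zero n) (sumSubsets-zero n)

sumSubsets-+ : ∀ n (f g : Subset n → ℕ) →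
  sumSubsets n (λ A → f A + g A) ≡ sumSubsets n f + sumSubsets n g
sumSubsets-+ zero    f g = refl
sumSubsets-+ (suc n) f g = begin
  sumSubsets n (λ A → f (true ∷ A) + g (true ∷ A)) + sumSubsets n (λ A → f (false ∷ A) + g (false ∷ A))
    ≡⟨ cong₂ _+_ (sumSubsets-+ n _ _) (sumSubsets-+ n _ _) ⟩
  (f₁ + g₁) + (f₀ + g₀)
    ≡⟨ interchange f₁ g₁ f₀ g₀ ⟩
  (f₁ + f₀) + (g₁ + g₀) ∎
  where
  f₁ = sumSubsets n (f ∘ (true ∷_))
  f₀ = sumSubsets n (f ∘ (false ∷_))
  g₁ = sumSubsets n (g ∘ (true ∷_))
  g₀ = sumSubsets n (g ∘ (false ∷_))

_=ᵇ_ : ∀ {n} → Subset n → Subset n → Bool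
u =ᵇ v = does (≡-dec _≟_ u v)

sumSubsets-point : ∀ m (C : Subset m) (g : Subset m → Bool) →
  sumSubsets m (λ B → 𝟙 ((C =ᵇ B) ∧ g B)) ≡ 𝟙 (g C)
sumSubsets-point zero    []          g = refl
sumSubsets-point (suc m) (true ∷ C)  g
  rewrite sumSubsets-zero m | sumSubsets-point m C (g ∘ (true ∷_)) = +-identityʳ _
sumSubsets-point (suc m) (false ∷ C) g
  rewrite sumSubsets-zero m | sumSubsets-point m C (g ∘ (false ∷_)) = refl

cl : ∀ {n m} → Context n m → Subset n → Subset n
cl I A = I ↓ (I ↑ A)

isClosed : ∀ {n m} → Context n m → Subset n → Bool
isClosed I A = cl I A =ᵇ A

-- A concept is determined by its extent, so |𝔅(K)| counts the closed object sets.
numConcepts≡closed : ∀ {n m} (I : Context n m) →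
  numConcepts I ≡ sumSubsets n (λ A → 𝟙 (isClosed I A))
numConcepts≡closed {n} {m} I = begin
  numConcepts I
    ≡⟨ length-filter≡count (isConcept? I) (cartesianProduct (allSubsets n) (allSubsets m)) ⟩
  sum (map concept (cartesianProduct (allSubsets n) (allSubsets m)))
    ≡⟨ sum-cartesianProduct concept (allSubsets n) (allSubsets m) ⟩
  sum (map (λ A → sum (map (λ B → concept (A , B)) (allSubsets m))) (allSubsets n))
    ≡⟨ sum-allSubsets n _ ⟩
  sumSubsets n (λ A → sum (map (λ B → concept (A , B)) (allSubsets m)))
    ≡⟨ sumSubsets-cong n (λ A → trans (sum-allSubsets m _) (sumSubsets-point m (I ↑ A) (λ B → (I ↓ B) =ᵇ A))) ⟩
  sumSubsets n (λ A → 𝟙 (isClosed I A)) ∎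
  where
  concept : Subset n × Subset m → ℕ
  concept p = 𝟙 (does (isConcept? I p))

allᶠ⁺ : ∀ {k} {f : Fin k → Bool} → (∀ i → f i ≡ true) → allᶠ f ≡ true
allᶠ⁺ {zero}      all-f = refl
allᶠ⁺ {suc k} all-f rewrite all-f zero = allᶠ⁺ (all-f ∘ suc)

allᶠ⁻ : ∀ {k} {f : Fin k → Bool} → allᶠ f ≡ true → ∀ i → f i ≡ true
allᶠ⁻ {suc k} {f} h i with f zero in f₀ | h
allᶠ⁻ {suc k} {f} h zero    | true | _  = f₀
allᶠ⁻ {suc k} {f} h (suc i) | true | h′ = allᶠ⁻ h′ i

allᶠ-cong : ∀ {k} {f g : Fin k → Bool} → (∀ i → f i ≡ g i) → allᶠ f ≡ allᶠ g
allᶠ-cong {zero}  f≗g = refl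
allᶠ-cong {suc k} f≗g = cong₂ _∧_ (f≗g zero) (allᶠ-cong (f≗g ∘ suc))

not∨-intro : ∀ {a b} → (a ≡ true → b ≡ true) → not a ∨ b ≡ true
not∨-intro {true}  a⇒b = a⇒b refl
not∨-intro {false} a⇒b = refl

vec-ext : ∀ {a n} {A : Set a} {u v : Vec A n} → (∀ i → lookup u i ≡ lookup v i) → u ≡ v
vec-ext {u = u} {v} u≗v = trans (sym (tabulate∘lookup u)) (trans (tabulate-cong u≗v) (tabulate∘lookup v))

disjointᵇ : ∀ {n} → Subset n → Subset n → Bool
disjointᵇ A E = allᶠ (λ g → not (lookup A g) ∨ not (lookup E g))

_⊆ᵇ_ : ∀ {n} → Subset n → Subset n → Bool
E ⊆ᵇ A = allᶠ (λ g → not (lookup E g) ∨ lookup A g)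

disjoint⁻ : ∀ {n} (A E : Subset n) → disjointᵇ A E ≡ true →
  ∀ g → lookup E g ≡ true → lookup A g ≡ false
disjoint⁻ A E A∩E≡∅ g = not∨not⇒ (lookup A g) (lookup E g) (allᶠ⁻ A∩E≡∅ g)
  where
  not∨not⇒ : ∀ a e → not a ∨ not e ≡ true → e ≡ true → a ≡ false
  not∨not⇒ false e    _  _ = refl
  not∨not⇒ true  true () _

-- A ↦ A ∪ E maps the sets disjoint from E bijectively onto the supersets of E.
sumSubsets-shift : ∀ n (E : Subset n) (f : Subset n → ℕ) →
  sumSubsets n (λ A → 𝟙 (disjointᵇ A E) * f (A ∪ E)) ≡ sumSubsets n (λ A → 𝟙 (E ⊆ᵇ A) * f A)
sumSubsets-shift zero    []         f = refl
sumSubsets-shift (suc n) (true ∷ E) f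
  rewrite sumSubsets-zero n | sumSubsets-shift n E (f ∘ (true ∷_)) = sym (+-identityʳ _)
sumSubsets-shift (suc n) (false ∷ E) f =
  cong₂ _+_ (sumSubsets-shift n E (f ∘ (true ∷_))) (sumSubsets-shift n E (f ∘ (false ∷_)))

∧not≡⇔≡∨ : ∀ {a c} e → (e ≡ true → c ≡ true) → (e ≡ true → a ≡ false) →
  (c ∧ not e ≡ a) ⇔ (c ≡ a ∨ e)
∧not≡⇔≡∨ true c-true a-false rewrite c-true refl | a-false refl = mk⇔ (λ _ → refl) (λ _ → refl)
∧not≡⇔≡∨ {a} {c} false _ _ = mk⇔
  (λ c≡a → trans (sym (∧-identityʳ c)) (trans c≡a (sym (∨-identityʳ a))))
  (λ c≡a → trans (∧-identityʳ c) (trans c≡a (∨-identityʳ a)))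

∩∁≡⇔≡∪ : ∀ {n} {A C E : Subset n} →
  (∀ g → lookup E g ≡ true → lookup C g ≡ true) → (∀ g → lookup E g ≡ true → lookup A g ≡ false) →
  (C ∩ ∁ E ≡ A) ⇔ (C ≡ A ∪ E)
∩∁≡⇔≡∪ {A = A} {C} {E} E⊆C A∩E≡∅ = mk⇔
  (λ C∖E≡A → vec-ext λ g → trans (to (pointwise g) (trans (sym (lookup-∖ g)) (at g C∖E≡A))) (sym (lookup-∪ g)))
  (λ C≡A∪E → vec-ext λ g → trans (lookup-∖ g) (from (pointwise g) (trans (at g C≡A∪E) (lookup-∪ g))))
  where
  open Equivalence
  at : ∀ g {u v : Subset _} → u ≡ v → lookup u g ≡ lookup v g
  at g = cong (λ w → lookup w g)
  lookup-∖ : ∀ g → lookup (C ∩ ∁ E) g ≡ lookup C g ∧ not (lookup E g)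
  lookup-∖ g = trans (lookup-zipWith _∧_ g C (∁ E)) (cong (lookup C g ∧_) (lookup-map g not E))
  lookup-∪ : ∀ g → lookup (A ∪ E) g ≡ lookup A g ∨ lookup E g
  lookup-∪ g = lookup-zipWith _∨_ g A E
  pointwise : ∀ g → (lookup C g ∧ not (lookup E g) ≡ lookup A g) ⇔ (lookup C g ≡ lookup A g ∨ lookup E g)
  pointwise g = ∧not≡⇔≡∨ (lookup E g) (E⊆C g) (A∩E≡∅ g)

module Extension {n m : ℕ} (I : Context n m) where

  E : Subset n
  E = emptyDD I

  J : Context n (suc m)
  J = addAttr I

  -- ∅' = M, so the objects of E = ∅'' have every attribute.
  E-full : ∀ {g} → lookup E g ≡ true → ∀ j → I g j ≡ true
  E-full {g} g∈E j = helper (lookup (I ↑ ⊥) j) ∅′-full (allᶠ⁻ (trans (sym (lookup∘tabulate _ g)) g∈E) j)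
    where
    ∅′-full : lookup (I ↑ ⊥) j ≡ true
    ∅′-full = trans (lookup∘tabulate _ j)
                    (allᶠ⁺ λ g′ → cong (λ b → not b ∨ I g′ j) (lookup-replicate g′ false))
    helper : ∀ b → b ≡ true → not b ∨ I g j ≡ true → I g j ≡ true
    helper b refl h = h

  E⊆cl : ∀ A g → lookup E g ≡ true → lookup (cl I A) g ≡ true
  E⊆cl A g g∈E = trans (lookup∘tabulate _ g) (allᶠ⁺ λ j → not∨-intro λ _ → E-full g∈E j)

  ↑-∪E : ∀ A → I ↑ (A ∪ E) ≡ I ↑ A
  ↑-∪E A = tabulate-cong λ j → allᶠ-cong λ g →
    trans (cong (λ b → not b ∨ I g j) (lookup-zipWith _∨_ g A E))
          (absorb (lookup A g) (lookup E g) (I g j) (λ g∈E → E-full g∈E j))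
    where
    absorb : ∀ a e i → (e ≡ true → i ≡ true) → not (a ∨ e) ∨ i ≡ not a ∨ i
    absorb a true  i e⇒i rewrite e⇒i refl = trans (∨-zeroʳ _) (sym (∨-zeroʳ _))
    absorb a false i e⇒i = cong (λ b → not b ∨ i) (∨-identityʳ a)

  ↓-addAttr : ∀ B → J ↓ (true ∷ B) ≡ (I ↓ B) ∩ ∁ E
  ↓-addAttr B = vec-ext λ g → begin
    lookup (J ↓ (true ∷ B)) g
      ≡⟨ lookup∘tabulate _ g ⟩
    not (lookup E g) ∧ allᶠ (λ j → not (lookup B j) ∨ I g j)
      ≡⟨ ∧-comm (not (lookup E g)) _ ⟩
    allᶠ (λ j → not (lookup B j) ∨ I g j) ∧ not (lookup E g)
      ≡⟨ cong₂ _∧_ (sym (lookup∘tabulate _ g)) (sym (lookup-map g not E)) ⟩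
    lookup (I ↓ B) g ∧ lookup (∁ E) g
      ≡⟨ lookup-zipWith _∧_ g (I ↓ B) (∁ E) ⟨
    lookup ((I ↓ B) ∩ ∁ E) g ∎

  -- Since a ∈ A' in K_a iff A ∩ E = ∅, a set meeting E has the same closure in K_a ...
  isClosed-meeting : ∀ A → disjointᵇ A E ≡ false → isClosed J A ≡ isClosed I A
  isClosed-meeting A A∩E≢∅ = cong (λ b → (J ↓ (b ∷ I ↑ A)) =ᵇ A) A∩E≢∅

  isClosed-disjoint : ∀ A → disjointᵇ A E ≡ true → isClosed J A ≡ isClosed I (A ∪ E)
  isClosed-disjoint A A∩E≡∅ = begin
    (J ↓ (disjointᵇ A E ∷ I ↑ A)) =ᵇ A ≡⟨ cong (λ b → (J ↓ (b ∷ I ↑ A)) =ᵇ A) A∩E≡∅ ⟩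
    (J ↓ (true ∷ I ↑ A)) =ᵇ A          ≡⟨ cong (_=ᵇ A) (↓-addAttr (I ↑ A)) ⟩
    (cl I A ∩ ∁ E) =ᵇ A                ≡⟨ does-⇔ (∩∁≡⇔≡∪ {A = A} {cl I A} {E} (E⊆cl A) (disjoint⁻ A E A∩E≡∅)) (≡-dec _≟_ _ _) (≡-dec _≟_ _ _) ⟩
    cl I A =ᵇ (A ∪ E)                  ≡⟨ cong (λ B → (I ↓ B) =ᵇ (A ∪ E)) (↑-∪E A) ⟨
    isClosed I (A ∪ E)                 ∎

  -- A closed set contains the nonempty E, so it cannot be disjoint from E.
  disjoint⇒not-closed : Nonempty E → ∀ A → disjointᵇ A E ≡ true → isClosed I A ≡ false
  disjoint⇒not-closed (g , g∈E) A A∩E≡∅ = dec-false (≡-dec _≟_ (cl I A) A) λ cl≡A →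
    contradiction (trans (sym (g∈A cl≡A)) (disjoint⁻ A E A∩E≡∅ g ([]=⇒lookup g∈E))) λ ()
    where
    g∈A : cl I A ≡ A → lookup A g ≡ true
    g∈A cl≡A = trans (sym (cong (λ v → lookup v g) cl≡A)) (E⊆cl A g ([]=⇒lookup g∈E))

  closed⇒E⊆ : ∀ A → 𝟙 (isClosed I A) ≡ 𝟙 (E ⊆ᵇ A) * 𝟙 (isClosed I A)
  closed⇒E⊆ A with ≡-dec _≟_ (cl I A) A
  ... | no  _     = sym (*-zeroʳ (𝟙 (E ⊆ᵇ A)))
  ... | yes cl≡A  = cong (λ b → 𝟙 b * 1) (sym (allᶠ⁺ λ g → not∨-intro λ g∈E →
                      trans (sym (cong (λ v → lookup v g) cl≡A)) (E⊆cl A g g∈E)))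

  closed-addAttr : Nonempty E → ∀ A →
    𝟙 (isClosed J A) ≡ 𝟙 (isClosed I A) + 𝟙 (disjointᵇ A E) * 𝟙 (isClosed I (A ∪ E))
  closed-addAttr ne A = by-cases (disjointᵇ A E) refl
    where
    by-cases : ∀ b → disjointᵇ A E ≡ b →
      𝟙 (isClosed J A) ≡ 𝟙 (isClosed I A) + 𝟙 b * 𝟙 (isClosed I (A ∪ E))
    by-cases false A∩E≢∅ = trans (cong 𝟙 (isClosed-meeting A A∩E≢∅)) (sym (+-identityʳ _))
    by-cases true  A∩E≡∅ = begin
      𝟙 (isClosed J A)                               ≡⟨ cong 𝟙 (isClosed-disjoint A A∩E≡∅) ⟩
      𝟙 (isClosed I (A ∪ E))                         ≡⟨ +-identityʳ _ ⟨
      𝟙 false + (𝟙 (isClosed I (A ∪ E)) + 0)         ≡⟨ cong (λ b → 𝟙 b + (𝟙 (isClosed I (A ∪ E)) + 0)) (disjoint⇒not-closed ne A A∩E≡∅) ⟨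
      𝟙 (isClosed I A) + (𝟙 (isClosed I (A ∪ E)) + 0) ∎

open Extension using (closed-addAttr; closed⇒E⊆)

corollary1 : {n m : ℕ} (I : Context n m) → Nonempty (emptyDD I) →
    numConcepts (addAttr I) ≡ 2 * numConcepts I
corollary1 {n} I ne = begin
  numConcepts (addAttr I)
    ≡⟨ numConcepts≡closed (addAttr I) ⟩
  sumSubsets n (λ A → 𝟙 (isClosed (addAttr I) A))
    ≡⟨ sumSubsets-cong n (closed-addAttr I ne) ⟩
  sumSubsets n (λ A → 𝟙 (isClosed I A) + 𝟙 (disjointᵇ A E) * 𝟙 (isClosed I (A ∪ E)))
    ≡⟨ sumSubsets-+ n _ _ ⟩
  S + sumSubsets n (λ A → 𝟙 (disjointᵇ A E) * 𝟙 (isClosed I (A ∪ E)))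
    ≡⟨ cong (S +_) (sumSubsets-shift n E (λ A → 𝟙 (isClosed I A))) ⟩
  S + sumSubsets n (λ A → 𝟙 (E ⊆ᵇ A) * 𝟙 (isClosed I A))
    ≡⟨ cong (S +_) (sumSubsets-cong n (closed⇒E⊆ I)) ⟨
  S + S
    ≡⟨ cong (S +_) (+-identityʳ S) ⟨
  2 * S
    ≡⟨ cong (2 *_) (numConcepts≡closed I) ⟨
  2 * numConcepts I ∎
  where
  E = emptyDD I
  S = sumSubsets n (λ A → 𝟙 (isClosed I A))
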